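{- Let $f\colon X'\to X$ be a $p$-morphism between partially ordered sets $X'$ and $X$. Then $f$ is a strict $p$-morphism if and only if for every upset $U$ of $X'$ the following holds in the Heyting algebra $\mathrm{Up}(X')$ of upsets of $X'$: \[\bigvee_{W\in \mathrm{Up}(X)}\big(U\Leftrightarrow f^{ -1}(W)\big)=X'.\]
   Context: An upset of a poset is a subset $A$ such that $a\in A$ and $a\leqslant a'$ imply $a'\in A$; $\mathrm{Up}(X)$ denotes the Heyting algebra of all upsets of $X$ ordered by inclusion (joins are unions). In a Heyting algebra, $a\Leftrightarrow b$ denotes $(a\Rightarrow b)\wedge(b\Rightarrow a)$. $f^{ -1}(W)=\{x\in X'\mid f(x)\in W\}$. A map $f$ of posets is a $p$-morphism if it is order-preserving and whenever $f(x)\leqslant y$ there is $x'\geqslant x$ with $f(x')=y$; it is strict if such $x'$ is always unique. -}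

module Defs where

open import Level using (Level; suc; _⊔_)
open import Relation.Binary.Core using (Rel)
open import Relation.Binary.Structures using (IsPartialOrder)
open import Relation.Binary.PropositionalEquality using (_≡_)
open import Relation.Unary using (Pred; _∈_)
open import Data.Product using (Σ; _×_; ∃; ∃-syntax)

record Pos (ℓ : Level) : Set (suc ℓ) where
  field
    Carrier : Set ℓ
    _≤_     : Rel Carrier ℓ
    isPartialOrder : IsPartialOrder _≡_ _≤_

open Pos public

module _ {ℓ : Level} (P : Pos ℓ) where
  private
    C = Carrier P
    _≤ₚ_ = _≤_ P

  IsUpset : Pred C ℓ → Set ℓ
  IsUpset A = ∀ {a a'} → a ∈ A → a ≤ₚ a' → a' ∈ A

  Up : Set (suc ℓ)
  Up = Σ (Pred C ℓ) IsUpset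

  _⇒ᵘ_ : Pred C ℓ → Pred C ℓ → Pred C ℓ
  (U ⇒ᵘ V) x = ∀ y → x ≤ₚ y → y ∈ U → y ∈ V

  -- a ⇔ b = (a ⇒ b) ∧ (b ⇒ a); meets in Up(P) are intersections.
  _⇔ᵘ_ : Pred C ℓ → Pred C ℓ → Pred C ℓ
  (U ⇔ᵘ V) x = (U ⇒ᵘ V) x × (V ⇒ᵘ U) x

module _ {ℓ : Level} (X' X : Pos ℓ) (f : Carrier X' → Carrier X) where

  IsOrderPreserving : Set ℓ
  IsOrderPreserving = ∀ {x y} → _≤_ X' x y → _≤_ X (f x) (f y)

  IsPMorphism : Set ℓ
  IsPMorphism = IsOrderPreserving ×
    (∀ x y → _≤_ X (f x) y → ∃[ x' ] (_≤_ X' x x' × f x' ≡ y))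

  IsStrictPMorphism : Set ℓ
  IsStrictPMorphism = IsPMorphism ×
    (∀ x y → _≤_ X (f x) y → ∀ x₁ x₂ →
       _≤_ X' x x₁ → f x₁ ≡ y → _≤_ X' x x₂ → f x₂ ≡ y → x₁ ≡ x₂)

  preimage : Pred (Carrier X) ℓ → Pred (Carrier X') ℓ
  preimage W x = f x ∈ W

  -- ⋁_{W ∈ Up(X)} (U ⇔ f⁻¹(W)) in Up(X'); joins are unions.
  joinCondition : Pred (Carrier X') ℓ → Pred (Carrier X') (suc ℓ)
  joinCondition U x = Σ (Up X) λ W → x ∈ (_⇔ᵘ_ X' U (preimage (Σ.proj₁ W)))

{-# OPTIONS --safe #-}

-- Both conditions are equivalent to f reflecting the order on every principal
-- upset ↑x: for a, b ≥ x, f a ≤ f b implies a ≤ b. For strictness, lift a along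
-- f a ≤ f b; uniqueness of lifts over x forces the lift to be b. For the join
-- condition, the witness at x for an upset U is the upward closure of f[U ∩ ↑x],
-- and conversely the join condition for U = ↑a at x yields a ≤ b.
module Submission where

open import Defs
open import Level using (Level)
open import Data.Product using (_×_; _,_; ∃-syntax)
open import Relation.Unary using (Pred; _∈_)
open import Function.Bundles using (_⇔_; mk⇔)
open import Function.Properties.Equivalence using () renaming (trans to ⇔-trans)
open import Relation.Binary.PropositionalEquality using (_≡_; refl; sym; trans; subst)
open import Relation.Binary.Structures using (IsPartialOrder)

module _ {ℓ : Level} (X' X : Pos ℓ) (f : Carrier X' → Carrier X) where
  private
    module X' = IsPartialOrder (isPartialOrder X')
    module X = IsPartialOrder (isPartialOrder X)
    _≤'_ = _≤_ X'
    _≤ₓ_ = _≤_ X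

  IsLocallyOrderReflecting : Set ℓ
  IsLocallyOrderReflecting =
    ∀ {x a b} → x ≤' a → x ≤' b → f a ≤ₓ f b → a ≤' b

  JoinCondition : Set (Level.suc ℓ)
  JoinCondition = ∀ (U : Pred (Carrier X') ℓ) → IsUpset X' U →
    ∀ x → x ∈ joinCondition X' X f U

  ↑ : Carrier X' → Pred (Carrier X') ℓ
  ↑ a = a ≤'_

  ↑-isUpset : ∀ a → IsUpset X' (↑ a)
  ↑-isUpset a = X'.trans

  strict⇒locallyOrderReflecting :
    IsStrictPMorphism X' X f → IsLocallyOrderReflecting
  strict⇒locallyOrderReflecting ((monotone , lift) , unique) {x} {a} {b} x≤a x≤b fa≤fb
    with lift a (f b) fa≤fb
  ... | a' , a≤a' , fa'≡fb = subst (a ≤'_) a'≡b a≤a'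
    where
    x≤a' : x ≤' a'
    x≤a' = X'.trans x≤a a≤a'

    fx≤fb : f x ≤ₓ f b
    fx≤fb = monotone x≤b

    a'≡b : a' ≡ b
    a'≡b = unique x (f b) fx≤fb a' b x≤a' fa'≡fb x≤b refl

  locallyOrderReflecting⇒strict :
    IsPMorphism X' X f → IsLocallyOrderReflecting → IsStrictPMorphism X' X f
  locallyOrderReflecting⇒strict pmorphism reflecting =
    pmorphism , λ x y _ x₁ x₂ x≤x₁ fx₁≡y x≤x₂ fx₂≡y →
      let fx₁≡fx₂ = trans fx₁≡y (sym fx₂≡y) in
      X'.antisym (reflecting x≤x₁ x≤x₂ (X.reflexive fx₁≡fx₂))
                 (reflecting x≤x₂ x≤x₁ (X.reflexive (sym fx₁≡fx₂)))

  strict⇔locallyOrderReflecting :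
    IsPMorphism X' X f → IsStrictPMorphism X' X f ⇔ IsLocallyOrderReflecting
  strict⇔locallyOrderReflecting pmorphism =
    mk⇔ strict⇒locallyOrderReflecting (locallyOrderReflecting⇒strict pmorphism)

  locallyOrderReflecting⇒joinCondition :
    IsLocallyOrderReflecting → JoinCondition
  locallyOrderReflecting⇒joinCondition reflecting U U-upset x =
    (W , W-upset) , U⇒f⁻¹W , f⁻¹W⇒U
    where
    W : Pred (Carrier X) ℓ
    W w = ∃[ y ] (x ≤' y × y ∈ U × f y ≤ₓ w)

    W-upset : IsUpset X W
    W-upset (y , x≤y , y∈U , fy≤w) w≤w' = y , x≤y , y∈U , X.trans fy≤w w≤w'

    U⇒f⁻¹W : x ∈ _⇒ᵘ_ X' U (preimage X' X f W)
    U⇒f⁻¹W y x≤y y∈U = y , x≤y , y∈U , X.refl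

    f⁻¹W⇒U : x ∈ _⇒ᵘ_ X' (preimage X' X f W) U
    f⁻¹W⇒U z x≤z (y , x≤y , y∈U , fy≤fz) = U-upset y∈U (reflecting x≤y x≤z fy≤fz)

  joinCondition⇒locallyOrderReflecting :
    JoinCondition → IsLocallyOrderReflecting
  joinCondition⇒locallyOrderReflecting join {x} {a} {b} x≤a x≤b fa≤fb
    with join (↑ a) (↑-isUpset a) x
  ... | (W , W-upset) , ↑a⇒f⁻¹W , f⁻¹W⇒↑a =
    f⁻¹W⇒↑a b x≤b (W-upset (↑a⇒f⁻¹W a x≤a X'.refl) fa≤fb)

  locallyOrderReflecting⇔joinCondition :
    IsLocallyOrderReflecting ⇔ JoinCondition
  locallyOrderReflecting⇔joinCondition =
    mk⇔ locallyOrderReflecting⇒joinCondition joinCondition⇒locallyOrderReflecting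

proposition2 : {ℓ : Level} (X' X : Pos ℓ) (f : Carrier X' → Carrier X) →
    IsPMorphism X' X f →
    (IsStrictPMorphism X' X f ⇔
      (∀ (U : Pred (Carrier X') ℓ) → IsUpset X' U →
        ∀ x → x ∈ joinCondition X' X f U))
proposition2 X' X f pmorphism =
  ⇔-trans (strict⇔locallyOrderReflecting X' X f pmorphism)
          (locallyOrderReflecting⇔joinCondition X' X f)
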